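{- Let $\mathcal{C}_{\mathbf{all}}$ be the class of all frames and $\mathcal{C}_{\mathbf{tra}}$ the class of all transitive frames. Then $\mathtt{Log}(\mathcal{C}_{\mathbf{all}})=\mathtt{Log}(\mathcal{C}_{\mathbf{tra}})$. Here a frame is transitive if every $R(\alpha)$ is a transitive relation.
   Context: **Language.** Let $\mathbf{At}$ be a countably infinite set of atoms and let $\mathbf{Ag}$ be a finite set of agents. A group is a nonempty subset of $\mathbf{Ag}$. Formulas are generated by $$A ::= p \mid (A\rightarrow A) \mid \top \mid \bot \mid (A\vee A) \mid (A\wedge A) \mid [\alpha]A \mid \langle\alpha\rangle A.$$ **Frames.** A frame is a triple $(W,\leq,R)$ where $W$ is a nonempty set, $\leq$ is a preorder on $W$, and $R$ assigns to each group $\alpha$ a binary relation $R(\alpha)$ on $W$. For binary relations $S,T$, write $s\,(S\circ T)\,t$ iff there is $u$ with $sSu$ and $uTt$. Write $\geq$ for the converse of $\leq$. **Models and satisfaction.** A valuation is a map $V:\mathbf{At}\to\wp(W)$ with each $V(p)$ upward closed under $\leq$. Satisfaction in a model $(W,\leq,R,V)$ is defined as follows: - $s\models p$ iff $s\in V(p)$; - $s\models A\rightarrow B$ iff for all $t\geq s$, either $t\not\models A$ or $t\models B$; - $s\models\top$, and $s\not\models\bot$; - $\vee$ and $\wedge$ are interpreted pointwise; - $s\models[\alpha]A$ iff for all $t$ with $s\,(\leq\circ R(\alpha))\,t$, $t\models A$; - $s\models\langle\alpha\rangle A$ iff there is $t$ with $s\,(\geq\circ R(\alpha))\,t$ and $t\models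 A$. A formula is valid in a frame if it is satisfied at every state of every model based on that frame. For a class $\mathcal{C}$ of frames, $\mathtt{Log}(\mathcal{C})$ is the set of formulas valid in every frame in $\mathcal{C}$. -}

module Defs where

open import Data.Nat using (ℕ)
open import Data.Fin.Subset using (Subset; Nonempty)
open import Data.Product using (Σ; ∃; _×_; _,_)
open import Data.Sum using (_⊎_)
open import Data.Empty using (⊥)
open import Data.Unit using (⊤)
open import Relation.Nullary using (¬_)
open import Relation.Binary using (Rel; IsPreorder; Transitive)
open import Relation.Binary.PropositionalEquality using (_≡_)
open import Level using (0ℓ)

Atom : Set
Atom = ℕ

Group : ℕ → Set
Group n = Σ (Subset n) Nonempty

data Form (n : ℕ) : Set where
  atom : Atom → Form n
  _⇒_  : Form n → Form n → Form n
  ⊤f   : Form n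
  ⊥f   : Form n
  _∨f_ : Form n → Form n → Form n
  _∧f_ : Form n → Form n → Form n
  □    : Group n → Form n → Form n
  ◇    : Group n → Form n → Form n

record Frame (n : ℕ) : Set₁ where
  field
    W       : Set
    inhabited : W
    _≤_     : Rel W 0ℓ
    isPre   : IsPreorder _≡_ _≤_
    R       : Group n → Rel W 0ℓ

_∘R_ : {W : Set} → Rel W 0ℓ → Rel W 0ℓ → Rel W 0ℓ
(S ∘R T) s t = ∃ λ u → S s u × T u t

flipR : {W : Set} → Rel W 0ℓ → Rel W 0ℓ
flipR S x y = S y x

module _ {n : ℕ} (F : Frame n) where
  open Frame F

  record Valuation : Set₁ where
    field
      V      : Atom → W → Set
      upward : ∀ p {s t} → s ≤ t → V p s → V p t

  _,_⊨_ : Valuation → W → Form n → Set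
  M , s ⊨ atom p = Valuation.V M p s
  M , s ⊨ (A ⇒ B) = ∀ t → s ≤ t → ¬ (M , t ⊨ A) ⊎ (M , t ⊨ B)
  M , s ⊨ ⊤f = ⊤
  M , s ⊨ ⊥f = ⊥
  M , s ⊨ (A ∨f B) = (M , s ⊨ A) ⊎ (M , s ⊨ B)
  M , s ⊨ (A ∧f B) = (M , s ⊨ A) × (M , s ⊨ B)
  M , s ⊨ □ α A = ∀ t → (_≤_ ∘R R α) s t → M , t ⊨ A
  M , s ⊨ ◇ α A = ∃ λ t → (flipR _≤_ ∘R R α) s t × (M , t ⊨ A)

  ValidIn : Form n → Set₁
  ValidIn A = (M : Valuation) (s : W) → M , s ⊨ A

IsTransitiveFrame : {n : ℕ} → Frame n → Set
IsTransitiveFrame F = ∀ α → Transitive (Frame.R F α)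

LogAll : {n : ℕ} → Form n → Set₁
LogAll {n} A = (F : Frame n) → ValidIn F A

LogTra : {n : ℕ} → Form n → Set₁
LogTra {n} A = (F : Frame n) → IsTransitiveFrame F → ValidIn F A

-- Every frame F can be replaced by its bipartite double F × Bool: the preorder ignores the
-- second coordinate, and R α only leads from a state (s , false) to a state (t , true) with
-- R α s t. No R α-path in the double has two steps, so every R α is vacuously transitive;
-- and since a modality only ever moves from layer false into layer true, while ≤ moves freely
-- between layers, the projection to F preserves and reflects truth under the pulled-back
-- valuation.
module Submission where

open import Defs
open import Data.Nat using (ℕ)
open import Data.Product using (_×_; _,_; proj₁)
open import Data.Sum using (inj₁; inj₂)
open import Data.Bool using (Bool; true; false)
open import Relation.Binary using (IsPreorder; Rel)
open import Relation.Binary.PropositionalEquality using (refl; isEquivalence)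
open import Level using (0ℓ)

module Bipartite {n : ℕ} (F : Frame n) where
  open Frame F
  open IsPreorder isPre using () renaming (refl to ≤-refl; trans to ≤-trans)

  data Step (α : Group n) : Rel (W × Bool) 0ℓ where
    step : ∀ {s t} → R α s t → Step α (s , false) (t , true)

  double : Frame n
  double = record
    { W         = W × Bool
    ; inhabited = inhabited , false
    ; _≤_       = λ x y → proj₁ x ≤ proj₁ y
    ; isPre     = record
      { isEquivalence = isEquivalence
      ; reflexive     = λ { refl → ≤-refl }
      ; trans         = ≤-trans
      }
    ; R         = Step
    }

  double-transitive : IsTransitiveFrame double
  double-transitive α (step _) ()

  liftValuation : Valuation F → Valuation double
  liftValuation M = record
    { V      = λ p x → Valuation.V M p (proj₁ x)
    ; upward = λ p → Valuation.upward M p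
    }

  module _ (M : Valuation F) where
    private
      M₂ = liftValuation M

    ⊨⇒⊨-double : ∀ A s b → _,_⊨_ F M s A → _,_⊨_ double M₂ (s , b) A
    ⊨-double⇒⊨ : ∀ A s b → _,_⊨_ double M₂ (s , b) A → _,_⊨_ F M s A

    ⊨⇒⊨-double (atom p) s b h = h
    ⊨⇒⊨-double (A ⇒ B) s b h (t , c) s≤t with h t s≤t
    ... | inj₁ ¬A = inj₁ (λ a → ¬A (⊨-double⇒⊨ A t c a))
    ... | inj₂ hB = inj₂ (⊨⇒⊨-double B t c hB)
    ⊨⇒⊨-double ⊤f s b h = h
    ⊨⇒⊨-double ⊥f s b ()
    ⊨⇒⊨-double (A ∨f B) s b (inj₁ hA) = inj₁ (⊨⇒⊨-double A s b hA)
    ⊨⇒⊨-double (A ∨f B) s b (inj₂ hB) = inj₂ (⊨⇒⊨-double B s b hB)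
    ⊨⇒⊨-double (A ∧f B) s b (hA , hB) = ⊨⇒⊨-double A s b hA , ⊨⇒⊨-double B s b hB
    ⊨⇒⊨-double (□ α A) s b h (t , .true) ((u , .false) , s≤u , step r) =
      ⊨⇒⊨-double A t true (h t (u , s≤u , r))
    ⊨⇒⊨-double (◇ α A) s b (t , (u , u≤s , r) , hA) =
      (t , true) , ((u , false) , u≤s , step r) , ⊨⇒⊨-double A t true hA

    ⊨-double⇒⊨ (atom p) s b h = h
    ⊨-double⇒⊨ (A ⇒ B) s b h t s≤t with h (t , b) s≤t
    ... | inj₁ ¬A = inj₁ (λ a → ¬A (⊨⇒⊨-double A t b a))
    ... | inj₂ hB = inj₂ (⊨-double⇒⊨ B t b hB)
    ⊨-double⇒⊨ ⊤f s b h = h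
    ⊨-double⇒⊨ ⊥f s b ()
    ⊨-double⇒⊨ (A ∨f B) s b (inj₁ hA) = inj₁ (⊨-double⇒⊨ A s b hA)
    ⊨-double⇒⊨ (A ∨f B) s b (inj₂ hB) = inj₂ (⊨-double⇒⊨ B s b hB)
    ⊨-double⇒⊨ (A ∧f B) s b (hA , hB) = ⊨-double⇒⊨ A s b hA , ⊨-double⇒⊨ B s b hB
    ⊨-double⇒⊨ (□ α A) s b h t (u , s≤u , r) =
      ⊨-double⇒⊨ A t true (h (t , true) ((u , false) , s≤u , step r))
    ⊨-double⇒⊨ (◇ α A) s b ((t , .true) , ((u , .false) , u≤s , step r) , hA) =
      t , (u , u≤s , r) , ⊨-double⇒⊨ A t true hA

  ValidIn-double⇒ValidIn : ∀ A → ValidIn double A → ValidIn F A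
  ValidIn-double⇒ValidIn A valid M s =
    ⊨-double⇒⊨ M A s false (valid (liftValuation M) (s , false))

LogAll⇒LogTra : ∀ {n} (A : Form n) → LogAll A → LogTra A
LogAll⇒LogTra A valid F _ = valid F

LogTra⇒LogAll : ∀ {n} (A : Form n) → LogTra A → LogAll A
LogTra⇒LogAll A valid F =
  ValidIn-double⇒ValidIn A (valid double double-transitive)
  where open Bipartite F

proposition14 : (n : ℕ) → (A : Form n) → (LogAll A → LogTra A) × (LogTra A → LogAll A)
proposition14 n A = LogAll⇒LogTra A , LogTra⇒LogAll A
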